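{- For any positive integers $k,m,n$ with $k\ge2$, there exists a graph $G$ whose vertex set can be partitioned into $V_1,\dots,V_k$ such that: 1. each edge of $G$ goes between $V_i$ and $V_{i+1}$ for some $i\in[k-1]$; 2. $|V_i|=n^{k-i-1}m^i$ for all $i\in[k-1]$, and $|V_k|=m^{k-1}$; 3. for all $i\in[k-1]$, each vertex in $V_i$ has exactly $m$ neighbours in $V_{i+1}$; 4. for all $i\in[2,k-1]$, each vertex in $V_i$ has exactly $n$ neighbours in $V_{i-1}$, and each vertex in $V_k$ has exactly $m$ neighbours in $V_{k-1}$; 5. for all $i<j$ in $[k]$ and all $u\in V_i$, $v\in V_j$, there is at most one path with $j-i$ edges that starts at $u$, passes successively through $V_{i+1},V_{i+2},\dots,V_{j-1}$, and ends at $v$.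
   Context: $[a]=\{1,\dots,a\}$ and $[a,b]=\{a,a+1,\dots,b\}$. -}

module Defs where

open import Data.Nat using (ℕ; zero; suc; _+_; _*_; _∸_; _^_; _≤_; _<_; _<?_)
open import Data.Bool using (Bool; true; false; if_then_else_)
open import Data.Fin using (Fin; zero; suc; toℕ; inject₁)
open import Data.Vec using (Vec; lookup; head; last)
open import Relation.Nullary using (does)
open import Relation.Binary.PropositionalEquality using (_≡_)

size : (k m n i : ℕ) → ℕ
size k m n i = if does (i <? k) then n ^ (k ∸ i ∸ 1) * m ^ i else m ^ (k ∸ 1)

-- Vertex set V_1 ⊔ … ⊔ V_k : a vertex is a level i ∈ [1,k] together with
-- an element of V_i ≅ Fin (size k m n i).  The partition is given by 'lvl'.
record Vtx (k m n : ℕ) : Set where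
  constructor vtx
  field
    lvl : ℕ
    lo  : 1 ≤ lvl
    hi  : lvl ≤ k
    idx : Fin (size k m n lvl)

open Vtx public

record Graph (V : Set) : Set where
  field
    Adj    : V → V → Bool
    sym    : ∀ u v → Adj u v ≡ Adj v u
    irrefl : ∀ v → Adj v v ≡ false

open Graph public

count : ∀ {N} → (Fin N → Bool) → ℕ
count {zero}  f = 0
count {suc N} f = (if f zero then 1 else 0) + count (λ y → f (suc y))

nbrsIn : ∀ {k m n} → Graph (Vtx k m n) → Vtx k m n →
         (j : ℕ) → 1 ≤ j → j ≤ k → ℕ
nbrsIn {k} {m} {n} G v j lo hi = count (λ y → Adj G v (vtx j lo hi y))

record LPath {k m n} (G : Graph (Vtx k m n)) (u v : Vtx k m n) : Set where
  field
    verts  : Vec (Vtx k m n) (suc (lvl v ∸ lvl u))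
    levels : ∀ s → lvl (lookup verts s) ≡ lvl u + toℕ s
    start  : head verts ≡ u
    end    : last verts ≡ v
    adj    : ∀ (s : Fin (lvl v ∸ lvl u)) →
             Adj G (lookup verts (inject₁ s)) (lookup verts (suc s)) ≡ true

open LPath public

-- Read a vertex x of V_t (t < k) in mixed radix as x = a + α t * b with a < α t = n^(k-t-1) and
-- b < β t = m^t.  For t + 1 < k, x ∈ V_t and y ∈ V_{t+1} are adjacent iff x / n ≡ y % (α (t+1) * β t):
-- y's a-part is a with its lowest base-n digit dropped and y's b-part extends b by one base-m digit.
-- Between V_{k-1} and V_k, both of size m^(k-1), x and y are adjacent iff x / m ≡ y / m.  So every layer
-- is a disjoint union of complete bipartite blocks, K_{n,m} in the middle and K_{m,m} at the top, which
-- gives the degrees.  Along an ascending path the a-part and the lowest base-m digit of the b-part are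
-- inherited from the start, and a vertex is determined by these data and by its block; walking back
-- from the common end vertex, two such paths with the same start therefore coincide.

module Submission where

open import Data.Bool using (Bool; true; false; if_then_else_; _∧_; _∨_)
open import Data.Bool.Properties using (∨-comm; ∨-identityʳ; ∧-conicalˡ)
open import Data.Sum using (_⊎_; inj₁; inj₂)
open import Data.Fin using (Fin; zero; suc; toℕ; inject₁)
open import Data.Fin.Properties using (toℕ-injective; toℕ<n)
open import Data.Vec using (Vec; []; _∷_; head; last; lookup)
open import Data.Product using (Σ; _×_; _,_)
open import Data.Nat
open import Data.Nat.DivMod
open import Data.Nat.Properties
open import Data.Nat.Divisibility using (_∣_; m∣m*n; n∣m*n)
open import Function using (_∘_)
open import Relation.Nullary using (Dec; yes; no; does; contradiction)
open import Relation.Nullary.Decidable using (dec-true; dec-false)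
open import Relation.Binary.PropositionalEquality
open import Defs hiding (sym)

dec-true⁻¹ : ∀ {a} {A : Set a} (a? : Dec A) → does a? ≡ true → A
dec-true⁻¹ (yes a) _ = a

countBelow : ℕ → (ℕ → Bool) → ℕ
countBelow zero    P = 0
countBelow (suc N) P = (if P 0 then 1 else 0) + countBelow N (P ∘ suc)

count-toℕ : ∀ {N} {f : Fin N → Bool} (P : ℕ → Bool) → (∀ y → f y ≡ P (toℕ y)) →
            count f ≡ countBelow N P
count-toℕ {zero}  P f≗P = refl
count-toℕ {suc N} P f≗P =
  cong₂ _+_ (cong (λ b → if b then 1 else 0) (f≗P zero)) (count-toℕ (P ∘ suc) (f≗P ∘ suc))

countBelow-cong : ∀ N {P Q : ℕ → Bool} → (∀ y → y < N → P y ≡ Q y) →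
                  countBelow N P ≡ countBelow N Q
countBelow-cong zero    P≗Q = refl
countBelow-cong (suc N) P≗Q =
  cong₂ _+_ (cong (λ b → if b then 1 else 0) (P≗Q 0 z<s))
            (countBelow-cong N (λ y y<N → P≗Q (suc y) (s<s y<N)))

countBelow-false : ∀ N {P : ℕ → Bool} → (∀ y → y < N → P y ≡ false) → countBelow N P ≡ 0
countBelow-false zero    P≡false = refl
countBelow-false (suc N) P≡false
  rewrite P≡false 0 z<s = countBelow-false N (λ y y<N → P≡false (suc y) (s<s y<N))

countBelow-true : ∀ N {P : ℕ → Bool} → (∀ y → y < N → P y ≡ true) → countBelow N P ≡ N
countBelow-true zero    P≡true = refl
countBelow-true (suc N) P≡true
  rewrite P≡true 0 z<s = cong suc (countBelow-true N (λ y y<N → P≡true (suc y) (s<s y<N)))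

countBelow-+ : ∀ a b (P : ℕ → Bool) →
               countBelow (a + b) P ≡ countBelow a P + countBelow b (λ z → P (a + z))
countBelow-+ zero    b P = refl
countBelow-+ (suc a) b P =
  trans (cong ((if P 0 then 1 else 0) +_) (countBelow-+ a b (P ∘ suc)))
        (sym (+-assoc (if P 0 then 1 else 0) (countBelow a (P ∘ suc)) _))

countBelow-≟ : ∀ {N c} → c < N → countBelow N (λ y → does (y ≟ c)) ≡ 1
countBelow-≟ {suc N} {zero}  _         = cong suc (countBelow-false N (λ _ _ → refl))
countBelow-≟ {suc N} {suc c} (s<s c<N) = countBelow-≟ c<N

[d+z]/d≡1+z/d : ∀ d .{{_ : NonZero d}} z → (d + z) / d ≡ suc (z / d)
[d+z]/d≡1+z/d d z = trans (m/n≡1+[m∸n]/n (m≤m+n d z)) (cong (λ w → suc (w / d)) (m+n∸m≡n d z))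

countBelow-/ : ∀ d .{{_ : NonZero d}} {Q c} → c < Q →
               countBelow (Q * d) (λ x → does (x / d ≟ c)) ≡ d
countBelow-/ d {suc Q} {c} c<Q = begin
  countBelow (d + Q * d) (λ x → does (x / d ≟ c))
    ≡⟨ countBelow-+ d (Q * d) _ ⟩
  countBelow d (λ x → does (x / d ≟ c)) + countBelow (Q * d) (λ z → does ((d + z) / d ≟ c))
    ≡⟨ cong (countBelow d (λ x → does (x / d ≟ c)) +_)
            (countBelow-cong (Q * d) (λ z _ → cong (λ w → does (w ≟ c)) ([d+z]/d≡1+z/d d z))) ⟩
  countBelow d (λ x → does (x / d ≟ c)) + countBelow (Q * d) (λ z → does (suc (z / d) ≟ c))
    ≡⟨ split c c<Q ⟩
  d ∎
  where
  open ≡-Reasoning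
  split : ∀ c → c < suc Q →
    countBelow d (λ x → does (x / d ≟ c)) + countBelow (Q * d) (λ z → does (suc (z / d) ≟ c)) ≡ d
  split zero    _         = trans (cong₂ _+_ (countBelow-true d (λ x x<d →
                                                 cong (λ w → does (w ≟ 0)) (m<n⇒m/n≡0 x<d)))
                                             (countBelow-false (Q * d) (λ _ _ → refl)))
                                  (+-identityʳ d)
  split (suc c) (s<s c<Q) = cong₂ _+_ (countBelow-false d (λ x x<d →
                                         cong (λ w → does (w ≟ suc c)) (m<n⇒m/n≡0 x<d)))
                                      (countBelow-/ d c<Q)

countBelow-% : ∀ Q .{{_ : NonZero Q}} M {c} → c < Q →
               countBelow (M * Q) (λ y → does (y % Q ≟ c)) ≡ M
countBelow-% Q zero    c<Q = refl
countBelow-% Q (suc M) {c} c<Q = begin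
  countBelow (Q + M * Q) (λ y → does (y % Q ≟ c))
    ≡⟨ countBelow-+ Q (M * Q) _ ⟩
  countBelow Q (λ y → does (y % Q ≟ c)) + countBelow (M * Q) (λ z → does ((Q + z) % Q ≟ c))
    ≡⟨ cong₂ _+_ (countBelow-cong Q (λ y y<Q → cong (λ w → does (w ≟ c)) (m<n⇒m%n≡m y<Q)))
                 (countBelow-cong (M * Q) (λ z _ → cong (λ w → does (w ≟ c)) [Q+z]%Q≡z%Q)) ⟩
  countBelow Q (λ y → does (y ≟ c)) + countBelow (M * Q) (λ z → does (z % Q ≟ c))
    ≡⟨ cong₂ _+_ (countBelow-≟ c<Q) (countBelow-% Q M c<Q) ⟩
  suc M ∎
  where
  open ≡-Reasoning
  [Q+z]%Q≡z%Q : ∀ {z} → (Q + z) % Q ≡ z % Q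
  [Q+z]%Q≡z%Q {z} = trans (cong (_% Q) (+-comm Q z)) ([m+n]%n≡m%n z Q)

does-≟-comm : ∀ a b → does (a ≟ b) ≡ does (b ≟ a)
does-≟-comm zero    zero    = refl
does-≟-comm zero    (suc b) = refl
does-≟-comm (suc a) zero    = refl
does-≟-comm (suc a) (suc b) = does-≟-comm a b

%-/-injective : ∀ d .{{_ : NonZero d}} {x y} → x % d ≡ y % d → x / d ≡ y / d → x ≡ y
%-/-injective d {x} {y} %≡ /≡ = begin
  x                 ≡⟨ m≡m%n+[m/n]*n x d ⟩
  x % d + x / d * d ≡⟨ cong₂ (λ r q → r + q * d) %≡ /≡ ⟩
  y % d + y / d * d ≡⟨ m≡m%n+[m/n]*n y d ⟨
  y                 ∎
  where open ≡-Reasoning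

module _ (a b d : ℕ) {e : ℕ} .{{_ : NonZero a}} .{{_ : NonZero b}} .{{_ : NonZero d}} .{{_ : NonZero e}}
         (e≡d*a : e ≡ d * a) where
  open ≡-Reasoning
  instance
    _ = m*n≢0 a b
    _ = m*n≢0 b a
    _ = m*n≢0 d a

  x/d≡y%ab⇒y%a≡x%e/d : ∀ {x y} → x / d ≡ y % (a * b) → y % a ≡ x % e / d
  x/d≡y%ab⇒y%a≡x%e/d {x} {y} x/d≡y%ab = begin
    y % a           ≡⟨ m∣n⇒o%n%m≡o%m a (a * b) y (m∣m*n b) ⟨
    y % (a * b) % a ≡⟨ cong (_% a) x/d≡y%ab ⟨
    x / d % a       ≡⟨ m%[n*o]/o≡m/o%n x a d ⟨
    x % (a * d) / d ≡⟨ cong (_/ d) (%-congʳ (trans (*-comm a d) (sym e≡d*a))) ⟩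
    x % e / d       ∎
    where instance _ = m*n≢0 a d

  x/d≡y%ab⇒y/a%c≡x/e%c : ∀ c .{{_ : NonZero c}} {x y} → c ∣ b → x / d ≡ y % (a * b) →
              y / a % c ≡ x / e % c
  x/d≡y%ab⇒y/a%c≡x/e%c c {x} {y} c∣b x/d≡y%ab = begin
    y / a % c           ≡⟨ m∣n⇒o%n%m≡o%m c b (y / a) c∣b ⟨
    y / a % b % c       ≡⟨ cong (_% c) (m%[n*o]/o≡m/o%n y b a) ⟨
    y % (b * a) / a % c ≡⟨ cong (λ w → w / a % c) (%-congʳ (*-comm b a)) ⟩
    y % (a * b) / a % c ≡⟨ cong (λ w → w / a % c) x/d≡y%ab ⟨
    x / d / a % c       ≡⟨ cong (_% c) (m/n/o≡m/[n*o] x d a) ⟩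
    x / (d * a) % c     ≡⟨ cong (_% c) (/-congʳ (sym e≡d*a)) ⟩
    x / e % c           ∎

module Construction (k m n : ℕ) .{{_ : NonZero m}} .{{_ : NonZero n}} where

  -- Opaque, so that instance search can recover t from a goal NonZero (α t).
  opaque
    α β : ℕ → ℕ
    α t = n ^ (k ∸ t ∸ 1)
    β t = m ^ t

  blocks : ℕ → ℕ
  blocks t = α (suc t) * β t

  opaque
    unfolding α β

    instance
      α≢0 : ∀ {t} → NonZero (α t)
      α≢0 {t} = m^n≢0 n (k ∸ t ∸ 1)
      β≢0 : ∀ {t} → NonZero (β t)
      β≢0 {t} = m^n≢0 m t

    α-suc : ∀ {t} → suc t < k → α t ≡ n * α (suc t)
    α-suc {t} st = cong (n ^_) (exponent k t st)
      where
      exponent : ∀ l s → suc s < l → l ∸ s ∸ 1 ≡ suc (l ∸ suc s ∸ 1)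
      exponent (suc (suc l)) zero    _        = refl
      exponent (suc l)       (suc s) (s<s ss) = exponent l s ss

    α-top : ∀ {t} → suc t ≡ k → α t ≡ 1
    α-top {t} refl = cong (λ e → n ^ (e ∸ 1)) (m+n∸n≡m 1 t)

    β-suc : ∀ t → β (suc t) ≡ β t * m
    β-suc t = *-comm m (β t)

    size-below : ∀ {t} → t < k → size k m n t ≡ α t * β t
    size-below {t} t<k = cong (if_then α t * β t else m ^ (k ∸ 1)) (dec-true (t <? k) t<k)

    size-upper-top : ∀ {t} → suc (suc t) ≡ k → size k m n (suc (suc t)) ≡ β t * m
    size-upper-top {t} refl = trans (cong (if_then α (suc (suc t)) * β (suc (suc t)) else β (suc t))
                                          (dec-false (suc (suc t) <? suc (suc t)) (n≮n (suc (suc t)))))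
                                    (β-suc t)

  instance
    blocks≢0 : ∀ {t} → NonZero (blocks t)
    blocks≢0 {t} = m*n≢0 (α (suc t)) (β t)

  size-lower-mid : ∀ {t} → suc t < k → size k m n t ≡ blocks t * n
  size-lower-mid {t} st = begin
    size k m n t               ≡⟨ size-below (<-trans (n<1+n t) st) ⟩
    α t * β t                  ≡⟨ cong (_* β t) (α-suc st) ⟩
    n * α (suc t) * β t        ≡⟨ *-assoc n (α (suc t)) (β t) ⟩
    n * blocks t               ≡⟨ *-comm n (blocks t) ⟩
    blocks t * n               ∎
    where open ≡-Reasoning

  size-upper-mid : ∀ {t} → suc t < k → size k m n (suc t) ≡ m * blocks t
  size-upper-mid {t} st = begin
    size k m n (suc t)      ≡⟨ size-below st ⟩
    α (suc t) * β (suc t)   ≡⟨ cong (α (suc t) *_) (β-suc t) ⟩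
    α (suc t) * (β t * m)   ≡⟨ *-assoc (α (suc t)) (β t) m ⟨
    blocks t * m            ≡⟨ *-comm (blocks t) m ⟩
    m * blocks t            ∎
    where open ≡-Reasoning

  size-lower-top : ∀ {t} → suc (suc t) ≡ k → size k m n (suc t) ≡ β t * m
  size-lower-top {t} refl = begin
    size k m n (suc t)      ≡⟨ size-below (n<1+n (suc t)) ⟩
    α (suc t) * β (suc t)   ≡⟨ cong (_* β (suc t)) (α-top refl) ⟩
    1 * β (suc t)           ≡⟨ *-identityˡ (β (suc t)) ⟩
    β (suc t)               ≡⟨ β-suc t ⟩
    β t * m                 ∎
    where open ≡-Reasoning

  lowerBlock upperBlock : ℕ → ℕ → ℕ
  lowerBlock t x with suc t <? k
  ... | yes _ = x / n
  ... | no  _ = x / m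
  upperBlock t y with suc t <? k
  ... | yes _ = y % blocks t
  ... | no  _ = y / m

  ix : Vtx k m n → ℕ
  ix v = toℕ (idx v)

  sameBlock : ℕ → ℕ → ℕ → Bool
  sameBlock t x y = does (lowerBlock t x ≟ upperBlock t y)

  linked : Vtx k m n → Vtx k m n → Bool
  linked v w = sameBlock (lvl v) (ix v) (ix w)

  up : Vtx k m n → Vtx k m n → Bool
  up v w = does (lvl w ≟ suc (lvl v)) ∧ linked v w

  up-self : ∀ v → up v v ≡ false
  up-self v = cong (_∧ linked v v) (dec-false (lvl v ≟ suc (lvl v)) (1+n≢n ∘ sym))

  graph : Graph (Vtx k m n)
  graph = record
    { Adj    = λ v w → up v w ∨ up w v
    ; sym    = λ v w → ∨-comm (up v w) (up w v)
    ; irrefl = λ v → cong₂ _∨_ (up-self v) (up-self v)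
    }

  up-levels : ∀ v w → up v w ≡ true → lvl w ≡ suc (lvl v)
  up-levels v w up-vw = dec-true⁻¹ (lvl w ≟ suc (lvl v)) (∧-conicalˡ _ _ up-vw)

  Adj-levels : ∀ v w → Adj graph v w ≡ true → lvl w ≡ suc (lvl v) ⊎ lvl v ≡ suc (lvl w)
  Adj-levels v w adj with up v w in up-vw
  ... | true  = inj₁ (up-levels v w up-vw)
  ... | false = inj₂ (up-levels w v adj)

  Adj-up : ∀ {v w} → lvl w ≡ suc (lvl v) → Adj graph v w ≡ linked v w
  Adj-up {v} {w} w≡1+v = begin
    up v w ∨ up w v         ≡⟨ cong₂ _∨_ (cong (_∧ linked v w) (dec-true (lvl w ≟ suc (lvl v)) w≡1+v))
                                         (cong (_∧ linked w v) (dec-false (lvl v ≟ suc (lvl w)) v≢1+w)) ⟩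
    linked v w ∨ false      ≡⟨ ∨-identityʳ (linked v w) ⟩
    linked v w              ∎
    where
    open ≡-Reasoning
    v≢1+w : lvl v ≢ suc (lvl w)
    v≢1+w v≡1+w = m≢1+n+m (lvl v) {1} (trans v≡1+w (cong suc w≡1+v))

  Adj-down : ∀ {v w} → lvl v ≡ suc (lvl w) → Adj graph v w ≡ linked w v
  Adj-down {v} {w} v≡1+w = trans (Graph.sym graph v w) (Adj-up {w} {v} v≡1+w)

  up-count : ∀ {t x} → 1 ≤ t → suc t ≤ k → x < size k m n t →
             countBelow (size k m n (suc t)) (sameBlock t x) ≡ m
  up-count {t} {x} _ _ x<size with suc t <? k
  ... | yes st = begin
    countBelow (size k m n (suc t)) (λ y → does (x / n ≟ y % blocks t))
      ≡⟨ cong (λ N → countBelow N (λ y → does (x / n ≟ y % blocks t))) (size-upper-mid st) ⟩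
    countBelow (m * blocks t) (λ y → does (x / n ≟ y % blocks t))
      ≡⟨ countBelow-cong (m * blocks t) (λ y _ → does-≟-comm (x / n) (y % blocks t)) ⟩
    countBelow (m * blocks t) (λ y → does (y % blocks t ≟ x / n))
      ≡⟨ countBelow-% (blocks t) m (m<n*o⇒m/o<n (subst (x <_) (size-lower-mid st) x<size)) ⟩
    m ∎
    where open ≡-Reasoning
  up-count {suc t} {x} _ 2+t≤k x<size | no ¬st = begin
    countBelow (size k m n (suc (suc t))) (λ y → does (x / m ≟ y / m))
      ≡⟨ cong (λ N → countBelow N (λ y → does (x / m ≟ y / m))) (size-upper-top top) ⟩
    countBelow (β t * m) (λ y → does (x / m ≟ y / m))
      ≡⟨ countBelow-cong (β t * m) (λ y _ → does-≟-comm (x / m) (y / m)) ⟩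
    countBelow (β t * m) (λ y → does (y / m ≟ x / m))
      ≡⟨ countBelow-/ m {β t} (m<n*o⇒m/o<n (subst (x <_) (size-lower-top top) x<size)) ⟩
    m ∎
    where
    open ≡-Reasoning
    top : suc (suc t) ≡ k
    top = ≤-antisym 2+t≤k (≮⇒≥ ¬st)

  down-count-mid : ∀ {t y} → suc t < k → countBelow (size k m n t) (λ x → sameBlock t x y) ≡ n
  down-count-mid {t} {y} st with suc t <? k
  ... | no ¬st = contradiction st ¬st
  ... | yes _  = trans (cong (λ N → countBelow N (λ x → does (x / n ≟ y % blocks t)))
                             (size-lower-mid st))
                       (countBelow-/ n {blocks t} (m%n<n y (blocks t)))

  down-count-top : ∀ {t y} → suc (suc t) ≡ k → y < size k m n (suc (suc t)) →
                   countBelow (size k m n (suc t)) (λ x → sameBlock (suc t) x y) ≡ m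
  down-count-top {t} {y} top y<size with suc (suc t) <? k
  ... | yes st = contradiction (subst (suc (suc t) <_) (sym top) st) (n≮n _)
  ... | no  _  = trans (cong (λ N → countBelow N (λ x → does (x / m ≟ y / m)))
                             (size-lower-top top))
                       (countBelow-/ m {β t} (m<n*o⇒m/o<n (subst (y <_) (size-upper-top top) y<size)))

  Agree : ℕ → ℕ → ℕ → Set
  Agree t x x′ = x % α t ≡ x′ % α t × x / α t % m ≡ x′ / α t % m

  Agree-reflexive : ∀ {t x x′} → x ≡ x′ → Agree t x x′
  Agree-reflexive refl = refl , refl

  Agree-step : ∀ {t x x′ y y′} → 1 ≤ t → suc t < k → Agree t x x′ →
               lowerBlock t x ≡ upperBlock t y → lowerBlock t x′ ≡ upperBlock t y′ →
               Agree (suc t) y y′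
  Agree-step {suc t} _ st (%≡ , /%≡) xy x′y′ with suc (suc t) <? k
  ... | no ¬st = contradiction st ¬st
  ... | yes _  = trans (tail xy) (trans (cong (_/ n) %≡) (sym (tail x′y′)))
               , trans (digit xy) (trans /%≡ (sym (digit x′y′)))
    where
    tail : ∀ {x y} → x / n ≡ y % blocks (suc t) → y % α (suc (suc t)) ≡ x % α (suc t) / n
    tail = x/d≡y%ab⇒y%a≡x%e/d (α (suc (suc t))) (β (suc t)) n (α-suc st)
    digit : ∀ {x y} → x / n ≡ y % blocks (suc t) → y / α (suc (suc t)) % m ≡ x / α (suc t) % m
    digit = x/d≡y%ab⇒y/a%c≡x/e%c (α (suc (suc t))) (β (suc t)) n (α-suc st) m
              (subst (m ∣_) (sym (β-suc t)) (n∣m*n (β t)))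

  lowerBlock-injective : ∀ {t x x′} → suc t ≤ k → Agree t x x′ →
                         lowerBlock t x ≡ lowerBlock t x′ → x ≡ x′
  lowerBlock-injective {t} {x} {x′} t<k (%≡ , /%≡) eq with suc t <? k
  ... | yes st = %-/-injective n (begin
    x % n          ≡⟨ m∣n⇒o%n%m≡o%m n (α t) x n∣α ⟨
    x % α t % n    ≡⟨ cong (_% n) %≡ ⟩
    x′ % α t % n   ≡⟨ m∣n⇒o%n%m≡o%m n (α t) x′ n∣α ⟩
    x′ % n         ∎) eq
    where
    open ≡-Reasoning
    n∣α : n ∣ α t
    n∣α = subst (n ∣_) (sym (α-suc st)) (m∣m*n (α (suc t)))
  ... | no ¬st = %-/-injective m (begin
    x % m          ≡⟨ cong (_% m) (x/α≡x x) ⟨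
    x / α t % m    ≡⟨ /%≡ ⟩
    x′ / α t % m   ≡⟨ cong (_% m) (x/α≡x x′) ⟩
    x′ % m         ∎) eq
    where
    open ≡-Reasoning
    x/α≡x : ∀ z → z / α t ≡ z
    x/α≡x z = trans (/-congʳ (α-top (≤-antisym t<k (≮⇒≥ ¬st)))) (n/1≡n z)

  Vtx-≡ : ∀ {v w : Vtx k m n} → lvl v ≡ lvl w → ix v ≡ ix w → v ≡ w
  Vtx-≡ {vtx l lo hi i} {vtx .l lo′ hi′ i′} refl i≡i′
    rewrite ≤-irrelevant lo lo′ | ≤-irrelevant hi hi′ | toℕ-injective i≡i′ = refl

  edge-blocks : ∀ {t v w} → lvl v ≡ t → lvl w ≡ suc t → Adj graph v w ≡ true →
                lowerBlock t (ix v) ≡ upperBlock t (ix w)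
  edge-blocks {v = v} {w} refl w≡1+v adj =
    dec-true⁻¹ (lowerBlock (lvl v) (ix v) ≟ upperBlock (lvl v) (ix w))
               (trans (sym (Adj-up {v} {w} w≡1+v)) adj)

  Rising : ∀ {L} → ℕ → Vec (Vtx k m n) L → Set
  Rising t ps = ∀ s → lvl (lookup ps s) ≡ t + toℕ s

  IsWalk : ∀ {L} → Vec (Vtx k m n) (suc L) → Set
  IsWalk {L} ps = ∀ (s : Fin L) → Adj graph (lookup ps (inject₁ s)) (lookup ps (suc s)) ≡ true

  -- Agree does not propagate into V_k, whose vertices have no a-part; hence the guard t < k.
  rising-walks-unique : ∀ {L t} (ps qs : Vec (Vtx k m n) (suc L)) → 1 ≤ t →
    Rising t ps → Rising t qs → IsWalk ps → IsWalk qs →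
    (t < k → Agree t (ix (head ps)) (ix (head qs))) → last ps ≡ last qs → ps ≡ qs
  rising-walks-unique (p ∷ []) (q ∷ []) _ _ _ _ _ _ p≡q = cong (_∷ []) p≡q
  rising-walks-unique {t = t} (x ∷ y ∷ ps) (x′ ∷ y′ ∷ qs)
                      1≤t rise rise′ walk walk′ agree last≡ =
    cong₂ _∷_ x≡x′ tail≡
    where
    lvl-x : lvl x ≡ t
    lvl-x = trans (rise zero) (+-identityʳ t)
    lvl-x′ : lvl x′ ≡ t
    lvl-x′ = trans (rise′ zero) (+-identityʳ t)
    lvl-y : lvl y ≡ suc t
    lvl-y = trans (rise (suc zero)) (+-comm t 1)
    lvl-y′ : lvl y′ ≡ suc t
    lvl-y′ = trans (rise′ (suc zero)) (+-comm t 1)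
    t<k : t < k
    t<k = subst (_≤ k) lvl-y (hi y)
    xy : lowerBlock t (ix x) ≡ upperBlock t (ix y)
    xy = edge-blocks {v = x} {y} lvl-x lvl-y (walk zero)
    x′y′ : lowerBlock t (ix x′) ≡ upperBlock t (ix y′)
    x′y′ = edge-blocks {v = x′} {y′} lvl-x′ lvl-y′ (walk′ zero)
    tail≡ : y ∷ ps ≡ y′ ∷ qs
    tail≡ = rising-walks-unique (y ∷ ps) (y′ ∷ qs) (s≤s z≤n)
              (λ s → trans (rise (suc s)) (+-suc t (toℕ s)))
              (λ s → trans (rise′ (suc s)) (+-suc t (toℕ s)))
              (walk ∘ suc) (walk′ ∘ suc)
              (λ st → Agree-step 1≤t st (agree t<k) xy x′y′) last≡
    x≡x′ : x ≡ x′
    x≡x′ = Vtx-≡ (trans lvl-x (sym lvl-x′))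
             (lowerBlock-injective t<k (agree t<k)
               (trans xy (trans (cong (upperBlock t ∘ ix ∘ head) tail≡) (sym x′y′))))

  LPath-unique : ∀ u v (p q : LPath graph u v) → verts p ≡ verts q
  LPath-unique u v p q =
    rising-walks-unique (verts p) (verts q) (lo u) (levels p) (levels q) (adj p) (adj q)
      (λ _ → Agree-reflexive (cong ix (trans (start p) (sym (start q)))))
      (trans (end p) (sym (end q)))

  nbrsIn-up : ∀ v (lo : 1 ≤ suc (lvl v)) (hi : suc (lvl v) ≤ k) →
              nbrsIn graph v (suc (lvl v)) lo hi ≡ m
  nbrsIn-up v@(vtx t 1≤t _ x) lo hi =
    trans (count-toℕ (sameBlock t (toℕ x)) (λ y → Adj-up {v} {vtx (suc t) lo hi y} refl))
          (up-count 1≤t hi (toℕ<n x))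

  nbrsIn-down-mid : ∀ v i (lo : 1 ≤ i) (hi : i ≤ k) → lvl v ≡ suc i → lvl v < k →
                    nbrsIn graph v i lo hi ≡ n
  nbrsIn-down-mid v@(vtx _ _ _ y) i lo hi refl st =
    trans (count-toℕ (λ x → sameBlock i x (toℕ y)) (λ x → Adj-down {v} {vtx i lo hi x} refl))
          (down-count-mid st)

  nbrsIn-down-top : ∀ v i (lo : 1 ≤ i) (hi : i ≤ k) → lvl v ≡ suc i → lvl v ≡ k →
                    nbrsIn graph v i lo hi ≡ m
  nbrsIn-down-top v@(vtx _ _ _ y) (suc i) lo hi refl top =
    trans (count-toℕ (λ x → sameBlock (suc i) x (toℕ y))
                     (λ x → Adj-down {v} {vtx (suc i) lo hi x} refl))
          (down-count-top top (toℕ<n y))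

lemma3p2 : (k m n : ℕ) → 2 ≤ k → 1 ≤ m → 1 ≤ n →
    Σ (Graph (Vtx k m n)) λ G →
      (∀ u v → Adj G u v ≡ true → lvl v ≡ suc (lvl u) ⊎ lvl u ≡ suc (lvl v))
      × (∀ v (lo : 1 ≤ suc (lvl v)) (hi : suc (lvl v) ≤ k) → nbrsIn G v (suc (lvl v)) lo hi ≡ m)
      × (∀ v i (lo : 1 ≤ i) (hi : i ≤ k) → lvl v ≡ suc i → lvl v < k → nbrsIn G v i lo hi ≡ n)
      × (∀ v i (lo : 1 ≤ i) (hi : i ≤ k) → lvl v ≡ suc i → lvl v ≡ k → nbrsIn G v i lo hi ≡ m)
      × (∀ u v → lvl u < lvl v → (p q : LPath G u v) → verts p ≡ verts q)
lemma3p2 k m n _ 1≤m 1≤n =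
  graph , Adj-levels , nbrsIn-up , nbrsIn-down-mid , nbrsIn-down-top , λ u v _ → LPath-unique u v
  where open Construction k m n {{>-nonZero 1≤m}} {{>-nonZero 1≤n}}
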